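{- Let $\varphi$ be a normal form $\mathrm{FO}^2[{\downarrow},{\downarrow_{+}},{\rightarrow},{\rightarrow^{+}}]$ formula, $\mathfrak{T}$ a finite tree model of $\varphi$, and $v,w$ two nodes of $\mathfrak{T}$ such that $\mathfrak{T}\models v\,{\downarrow_{+}}\,w$ and $\mathrm{rftp}^{\mathfrak{T}}(v)=\mathrm{rftp}^{\mathfrak{T}}(w)$. Then the tree $\mathfrak{T}'$ obtained from $\mathfrak{T}$ by replacing the subtree rooted at $v$ by the subtree rooted at $w$ is a model of $\varphi$.
   Context: Trees: finite unranked trees over $\tau_0\cup\{{\downarrow},{\downarrow_{+}},{\rightarrow},{\rightarrow^{+}}\}$ ($x{\downarrow}y$: $y$ child of $x$; $x{\rightarrow}y$: $y$ immediate right sibling of $x$; ${\downarrow_{+}},{\rightarrow^{+}}$ transitive closures; $\tau_0$ unary symbols). The 1-type $\mathrm{tp}(u)$ of a node is the set of unary predicates true at $u$. The reduced full type $\mathrm{rftp}^{\mathfrak{T}}(u)$ is the tuple $(\alpha,A,B,F)$ where $\alpha=\mathrm{tp}(u)$, $A$ is the set of 1-types of proper ancestors of $u$, $B$ the set of 1-types of proper descendants of $u$, and $F$ the set of 1-types of nodes $u'\neq u$ that are neither ancestors nor descendants of $u$ (siblings of $u$ and nodes in free position). Normal form: $\varphi=\forall xy\,\chi(x,y)\wedge\bigwedge_{i\in I}\forall x(\lambda_i(x)\Rightarrow\exists y(\eta_i(x,y)\wedge\psi_i(x,y)))$ with $\chi$ quantifier-free (equality allowed), $\lambda_i(x)$ a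 unary atom, $\psi_i$ a boolean combination of unary atoms, and $\eta_i$ one of the ten order formulas $x{\downarrow}y$, $y{\downarrow}x$, $x{\downarrow_{+}}y\wedge\neg x{\downarrow}y$, $y{\downarrow_{+}}x\wedge\neg y{\downarrow}x$, $x{\rightarrow}y$, $y{\rightarrow}x$, $x{\rightarrow^{+}}y\wedge\neg x{\rightarrow}y$, $y{\rightarrow^{+}}x\wedge\neg y{\rightarrow}x$, $x\not\sim y$ (i.e. $x\ne y$ and none of $x{\downarrow_{+}}y,y{\downarrow_{+}}x,x{\rightarrow^{+}}y,y{\rightarrow^{+}}x$), $x{=}y$. -}

module Defs where

open import Data.Nat using (ℕ; zero; suc; _<_)
open import Data.Fin using (Fin)
open import Data.Fin.Subset using (Subset; _∈_)
open import Data.List using (List; []; _∷_; [_]; _++_)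
open import Data.List.Relation.Unary.All using (All)
open import Data.Maybe using (Maybe; just; nothing; map)
open import Data.Product using (Σ; ∃; ∃-syntax; _×_; _,_)
open import Data.Sum using (_⊎_)
open import Data.Empty using (⊥)
open import Function.Bundles using (_⇔_)
open import Relation.Nullary using (¬_)
open import Relation.Binary.PropositionalEquality using (_≡_; _≢_)

-- Finite unranked ordered trees labelled by 1-types over k unary
-- predicates P₀ … P_{k-1}  (τ₀ = Fin k).  A 1-type is a subset of Fin k.

OneType : ℕ → Set
OneType k = Subset k

data Tree (k : ℕ) : Set where
  node : OneType k → List (Tree k) → Tree k

rootTp : ∀ {k} → Tree k → OneType k
rootTp (node α _) = α

-- Nodes are addressed by paths: the list of child indices (0-based)
-- from the root.
Path : Set
Path = List ℕ

mutual
  subAt : ∀ {k} → Tree k → Path → Maybe (Tree k)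
  subAt t [] = just t
  subAt (node α ts) (i ∷ p) = subAtL ts i p

  subAtL : ∀ {k} → List (Tree k) → ℕ → Path → Maybe (Tree k)
  subAtL [] i p = nothing
  subAtL (t ∷ ts) zero p = subAt t p
  subAtL (t ∷ ts) (suc i) p = subAtL ts i p

IsNode : ∀ {k} → Tree k → Path → Set
IsNode t p = ∃[ s ] (subAt t p ≡ just s)

tpAt : ∀ {k} → Tree k → Path → Maybe (OneType k)
tpAt t p = map rootTp (subAt t p)

mutual
  replace : ∀ {k} → Tree k → Path → Tree k → Tree k
  replace t [] s = s
  replace (node α ts) (i ∷ p) s = node α (replaceL ts i p s)

  replaceL : ∀ {k} → List (Tree k) → ℕ → Path → Tree k → List (Tree k)
  replaceL [] i p s = []
  replaceL (t ∷ ts) zero p s = replace t p s ∷ ts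
  replaceL (t ∷ ts) (suc i) p s = t ∷ replaceL ts i p s

_↓_ : Path → Path → Set
x ↓ y = ∃[ i ] (y ≡ x ++ [ i ])

_↓₊_ : Path → Path → Set
x ↓₊ y = ∃[ q ] (q ≢ [] × y ≡ x ++ q)

_⟶_ : Path → Path → Set
x ⟶ y = ∃[ p ] ∃[ i ] (x ≡ p ++ [ i ] × y ≡ p ++ [ suc i ])

_⟶⁺_ : Path → Path → Set
x ⟶⁺ y = ∃[ p ] ∃[ i ] ∃[ j ] (i < j × x ≡ p ++ [ i ] × y ≡ p ++ [ j ])

_≁_ : Path → Path → Set
x ≁ y = x ≢ y × ¬ (x ↓₊ y) × ¬ (y ↓₊ x) × ¬ (x ⟶⁺ y) × ¬ (y ⟶⁺ x)

data Var : Set where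
  vx vy : Var

data Atom (k : ℕ) : Set where
  unA   : Fin k → Var → Atom k
  eqA   : Var → Var → Atom k
  chA   : Var → Var → Atom k
  dsA   : Var → Var → Atom k
  nxA   : Var → Var → Atom k
  rsA   : Var → Var → Atom k

data QF (k : ℕ) : Set where
  atom : Atom k → QF k
  neg  : QF k → QF k
  and  : QF k → QF k → QF k
  or   : QF k → QF k → QF k

data UB (k : ℕ) : Set where
  uatom : Fin k → Var → UB k
  uneg  : UB k → UB k
  uand  : UB k → UB k → UB k
  uor   : UB k → UB k → UB k

data Ord : Set where
  child parent descNC ancNC next prev foll precNC free same : Ord

-- a conjunct  ∀x (λ(x) ⇒ ∃y (η(x,y) ∧ ψ(x,y)))  with λ(x) = P_lam(x)
record Conj (k : ℕ) : Set where
  constructor conj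
  field
    lam : Fin k
    eta : Ord
    psi : UB k

-- normal form  ∀xy χ(x,y) ∧ ⋀_{i∈I} …  (I finite, given as a list)
record NF (k : ℕ) : Set where
  constructor nf
  field
    chi   : QF k
    conjs : List (Conj k)

env : Path → Path → Var → Path
env x y vx = x
env x y vy = y

HoldsP : ∀ {k} → Tree k → Fin k → Path → Set
HoldsP t j u = ∃[ α ] (tpAt t u ≡ just α × j ∈ α)

⟦_⟧A : ∀ {k} → Atom k → Tree k → Path → Path → Set
⟦ unA j v ⟧A t x y = HoldsP t j (env x y v)
⟦ eqA a b ⟧A t x y = env x y a ≡ env x y b
⟦ chA a b ⟧A t x y = env x y a ↓ env x y b
⟦ dsA a b ⟧A t x y = env x y a ↓₊ env x y b
⟦ nxA a b ⟧A t x y = env x y a ⟶ env x y b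
⟦ rsA a b ⟧A t x y = env x y a ⟶⁺ env x y b

⟦_⟧Q : ∀ {k} → QF k → Tree k → Path → Path → Set
⟦ atom a ⟧Q t x y = ⟦ a ⟧A t x y
⟦ neg φ ⟧Q t x y = ¬ ⟦ φ ⟧Q t x y
⟦ and φ ψ ⟧Q t x y = ⟦ φ ⟧Q t x y × ⟦ ψ ⟧Q t x y
⟦ or φ ψ ⟧Q t x y = ⟦ φ ⟧Q t x y ⊎ ⟦ ψ ⟧Q t x y

⟦_⟧U : ∀ {k} → UB k → Tree k → Path → Path → Set
⟦ uatom j v ⟧U t x y = HoldsP t j (env x y v)
⟦ uneg φ ⟧U t x y = ¬ ⟦ φ ⟧U t x y
⟦ uand φ ψ ⟧U t x y = ⟦ φ ⟧U t x y × ⟦ ψ ⟧U t x y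
⟦ uor φ ψ ⟧U t x y = ⟦ φ ⟧U t x y ⊎ ⟦ ψ ⟧U t x y

⟦_⟧O : Ord → Path → Path → Set
⟦ child  ⟧O x y = x ↓ y
⟦ parent ⟧O x y = y ↓ x
⟦ descNC ⟧O x y = x ↓₊ y × ¬ (x ↓ y)
⟦ ancNC  ⟧O x y = y ↓₊ x × ¬ (y ↓ x)
⟦ next   ⟧O x y = x ⟶ y
⟦ prev   ⟧O x y = y ⟶ x
⟦ foll   ⟧O x y = x ⟶⁺ y × ¬ (x ⟶ y)
⟦ precNC ⟧O x y = y ⟶⁺ x × ¬ (y ⟶ x)
⟦ free   ⟧O x y = x ≁ y
⟦ same   ⟧O x y = x ≡ y

SatConj : ∀ {k} → Tree k → Conj k → Set
SatConj t (conj l η ψ) =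
  ∀ x → IsNode t x → HoldsP t l x →
    ∃[ y ] (IsNode t y × ⟦ η ⟧O x y × ⟦ ψ ⟧U t x y)

_⊨_ : ∀ {k} → Tree k → NF k → Set
t ⊨ nf χ cs =
  (∀ x y → IsNode t x → IsNode t y → ⟦ χ ⟧Q t x y) × All (SatConj t) cs

-- rftp(u) = (α, A, B, F); sets of 1-types are predicates on OneType k
record Rftp (k : ℕ) : Set₁ where
  constructor rftp-mk
  field
    α : Maybe (OneType k)
    A : OneType k → Set
    B : OneType k → Set
    F : OneType k → Set

rftp : ∀ {k} → Tree k → Path → Rftp k
rftp t u = rftp-mk
  (tpAt t u)
  (λ β → ∃[ a ] (a ↓₊ u × tpAt t a ≡ just β))
  (λ β → ∃[ d ] (u ↓₊ d × tpAt t d ≡ just β))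
  (λ β → ∃[ u' ] (u' ≢ u × ¬ (u' ↓₊ u) × ¬ (u ↓₊ u') × tpAt t u' ≡ just β))

_≈R_ : ∀ {k} → Rftp k → Rftp k → Set
r ≈R s = Rftp.α r ≡ Rftp.α s
       × (∀ β → Rftp.A r β ⇔ Rftp.A s β)
       × (∀ β → Rftp.B r β ⇔ Rftp.B s β)
       × (∀ β → Rftp.F r β ⇔ Rftp.F s β)

-- Every node of the new tree is matched with a node of the old one carrying the same
-- 1-type: nodes outside the subtree at v stay where they are, and the node v·q of the
-- transplanted subtree corresponds to w·q.  Matched pairs stand in the same navigational
-- relations, because a node strictly below v sees a node outside v's subtree only through
-- the question whether that node is an ancestor of v.  Hence the universal part χ
-- transfers.  A witness for an existential conjunct is moved along in the same way; when
-- it falls on the wrong side of the subtree boundary (a proper descendant of v seen from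
-- outside, or a node outside w's subtree seen from strictly below w), the equality of the
-- reduced full types of v and w supplies a node of the same 1-type in the right place.
module Submission where

open import Defs
open import Data.Nat using (ℕ; zero; suc; _≟_)
open import Data.Nat.Properties using (<-irrefl; n<1+n)
open import Data.List using (List; []; _∷_; [_]; _++_)
open import Data.List.Properties using (++-assoc; ++-identityʳ; ++-cancelˡ; ++-conicalˡ; ++-conicalʳ; ∷-injective)
import Data.List.Relation.Unary.All as All
open import Data.Maybe using (just; nothing; map)
open import Data.Product using (∃-syntax; _×_; _,_; proj₁; proj₂; map₂; swap)
open import Data.Product.Function.NonDependent.Propositional using (_×-⇔_)
open import Data.Sum as Sum using (_⊎_; inj₁; inj₂; [_,_]′)
open import Data.Sum.Function.Propositional using (_⊎-⇔_)
open import Data.Empty using (⊥-elim)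
open import Function using (_∘_; id)
open import Level using (0ℓ)
open import Function.Bundles using (_⇔_; mk⇔; Equivalence)
open import Function.Properties.Equivalence using (⇔-isEquivalence)
open import Function.Related.TypeIsomorphisms using (¬-cong-⇔)
open import Relation.Binary.Structures using (IsEquivalence)
open import Relation.Nullary using (¬_; Dec; yes; no)
open import Relation.Binary.PropositionalEquality using (_≡_; _≢_; refl; sym; trans; cong; module ≡-Reasoning)

open IsEquivalence (⇔-isEquivalence {0ℓ}) using () renaming (refl to ⇔-refl; sym to ⇔-sym; trans to ⇔-trans)
open Equivalence using (to; from)

⇔-absurd : ∀ {A B : Set} → ¬ A → ¬ B → A ⇔ B
⇔-absurd ¬a ¬b = mk⇔ (⊥-elim ∘ ¬a) (⊥-elim ∘ ¬b)

infix 4 _≼_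

_≼_ : Path → Path → Set
b ≼ x = ∃[ q ] (x ≡ b ++ q)

≼-reflexive : ∀ {a b} → a ≡ b → a ≼ b
≼-reflexive {b = b} refl = [] , sym (++-identityʳ b)

≼-refl : ∀ {a} → a ≼ a
≼-refl = ≼-reflexive refl

≼-++ : ∀ {a q} → a ≼ a ++ q
≼-++ {q = q} = q , refl

≼-trans : ∀ {a b c} → a ≼ b → b ≼ c → a ≼ c
≼-trans {a} (q , refl) (q' , refl) = q ++ q' , ++-assoc a q q'

∷-≼ : ∀ {i a b} → a ≼ b → i ∷ a ≼ i ∷ b
∷-≼ {i} = map₂ (cong (i ∷_))

∷-≼⁻ : ∀ {i a b} → i ∷ a ≼ i ∷ b → a ≼ b
∷-≼⁻ = map₂ (proj₂ ∘ ∷-injective)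

_≼?_ : ∀ a b → Dec (a ≼ b)
[] ≼? b = yes (b , refl)
(i ∷ a) ≼? [] = no λ { (_ , ()) }
(i ∷ a) ≼? (j ∷ b) with i ≟ j | a ≼? b
... | yes refl | yes a≼b = yes (∷-≼ a≼b)
... | yes refl | no a⋠b = no (a⋠b ∘ ∷-≼⁻)
... | no i≢j | _ = no λ { (_ , e) → i≢j (sym (proj₁ (∷-injective e))) }

++-comparable : ∀ a b {x y} → a ++ x ≡ b ++ y → a ≼ b ⊎ b ≼ a
++-comparable [] b _ = inj₁ (b , refl)
++-comparable (i ∷ a) [] _ = inj₂ (i ∷ a , refl)
++-comparable (i ∷ a) (j ∷ b) e with ∷-injective e
... | refl , e' = Sum.map ∷-≼ ∷-≼ (++-comparable a b e')

≼-parent : ∀ b {q p i} → q ≢ [] → b ++ q ≡ p ++ [ i ] → b ≼ p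
≼-parent [] _ _ = _ , refl
≼-parent (c ∷ b) {q} {[]} q≢[] e = ⊥-elim (q≢[] (++-conicalʳ b q (proj₂ (∷-injective e))))
≼-parent (c ∷ b) {p = d ∷ p} q≢[] e with ∷-injective e
... | refl , e' = ∷-≼ (≼-parent b q≢[] e')

sibling-≼ : ∀ p {i j} → p ++ [ i ] ≼ p ++ [ j ] → j ≡ i
sibling-≼ p {i} (q , e) = proj₁ (∷-injective (++-cancelˡ p _ _ (trans e (++-assoc p [ i ] q))))

data Position (v : Path) : Path → Set where
  outside : ∀ {x} → ¬ v ≼ x → Position v x
  inside  : ∀ q → Position v (v ++ q)

position : ∀ v x → Position v x
position v x with v ≼? x
... | yes (q , refl) = inside q
... | no v⋠x = outside v⋠x

↓⇒↓₊ : ∀ {a b} → a ↓ b → a ↓₊ b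
↓⇒↓₊ (i , e) = [ i ] , (λ ()) , e

⟶⇒⟶⁺ : ∀ {a b} → a ⟶ b → a ⟶⁺ b
⟶⇒⟶⁺ (p , i , e₁ , e₂) = p , i , suc i , n<1+n i , e₁ , e₂

↓₊⇒≼ : ∀ {a b} → a ↓₊ b → a ≼ b
↓₊⇒≼ (q , _ , e) = q , e

≼⇒≡⊎↓₊ : ∀ {a b} → a ≼ b → b ≡ a ⊎ a ↓₊ b
≼⇒≡⊎↓₊ {a} ([] , e) = inj₁ (trans e (++-identityʳ a))
≼⇒≡⊎↓₊ (c ∷ q , e) = inj₂ (c ∷ q , (λ ()) , e)

↓₊-≼-trans : ∀ {a b c} → a ↓₊ b → b ≼ c → a ↓₊ c
↓₊-≼-trans {a} (m , m≢[] , refl) (q , refl) = m ++ q , m≢[] ∘ ++-conicalˡ m q , ++-assoc a m q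

↓₊-irrefl : ∀ {a} → ¬ a ↓₊ a
↓₊-irrefl {a} (q , q≢[] , e) = q≢[] (sym (++-cancelˡ a [] q (trans (++-identityʳ a) e)))

↓₊⇒⋡ : ∀ {a y} → y ↓₊ a → ¬ a ≼ y
↓₊⇒⋡ y↓₊a = ↓₊-irrefl ∘ ↓₊-≼-trans y↓₊a

⟶⁺⇒⋡ : ∀ {a y} → a ⟶⁺ y → ¬ a ≼ y
⟶⁺⇒⋡ (p , i , j , i<j , refl , refl) a≼y = <-irrefl (sym (sibling-≼ p a≼y)) i<j

⟶⁺⇒⋡˘ : ∀ {a y} → y ⟶⁺ a → ¬ a ≼ y
⟶⁺⇒⋡˘ (p , i , j , i<j , refl , refl) a≼y = <-irrefl (sibling-≼ p a≼y) i<j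

⟶⁺-irrefl : ∀ {a} → ¬ a ⟶⁺ a
⟶⁺-irrefl a⟶⁺a = ⟶⁺⇒⋡ a⟶⁺a ≼-refl

_↓₊?_ : ∀ a b → Dec (a ↓₊ b)
a ↓₊? b with a ≼? b
... | no a⋠b = no (a⋠b ∘ ↓₊⇒≼)
... | yes ([] , e) = no λ { (m , m≢[] , e') → m≢[] (++-cancelˡ a m [] (trans (sym e') e)) }
... | yes (c ∷ q , e) = yes (c ∷ q , (λ ()) , e)

data Axis : Set where
  ↓ᵃ ↓₊ᵃ ⟶ᵃ ⟶⁺ᵃ ≡ᵃ : Axis

_⟨_⟩_ : Path → Axis → Path → Set
x ⟨ ↓ᵃ ⟩ y = x ↓ y
x ⟨ ↓₊ᵃ ⟩ y = x ↓₊ y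
x ⟨ ⟶ᵃ ⟩ y = x ⟶ y
x ⟨ ⟶⁺ᵃ ⟩ y = x ⟶⁺ y
x ⟨ ≡ᵃ ⟩ y = x ≡ y

Agree : Path → Path → Path → Path → Set
Agree a b a' b' = ∀ ρ → a ⟨ ρ ⟩ b ⇔ a' ⟨ ρ ⟩ b'

SameOrder : Path → Path → Path → Path → Set
SameOrder a b a' b' = Agree a b a' b' × Agree b a b' a'

sameOrder-refl : ∀ {a b} → SameOrder a b a b
sameOrder-refl = (λ _ → ⇔-refl) , (λ _ → ⇔-refl)

agree-self : ∀ a a' → Agree a a a' a'
agree-self a a' ↓ᵃ = ⇔-absurd (↓₊-irrefl ∘ ↓⇒↓₊) (↓₊-irrefl ∘ ↓⇒↓₊)
agree-self a a' ↓₊ᵃ = ⇔-absurd ↓₊-irrefl ↓₊-irrefl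
agree-self a a' ⟶ᵃ = ⇔-absurd (⟶⁺-irrefl ∘ ⟶⇒⟶⁺) (⟶⁺-irrefl ∘ ⟶⇒⟶⁺)
agree-self a a' ⟶⁺ᵃ = ⇔-absurd ⟶⁺-irrefl ⟶⁺-irrefl
agree-self a a' ≡ᵃ = mk⇔ (λ _ → refl) (λ _ → refl)

sameOrder-self : ∀ a a' → SameOrder a a a' a'
sameOrder-self a a' = agree-self a a' , agree-self a a'

∷-agree : ∀ i a b → Agree (i ∷ a) (i ∷ b) a b
∷-agree i a b ↓ᵃ = mk⇔ (map₂ (proj₂ ∘ ∷-injective)) (map₂ (cong (i ∷_)))
∷-agree i a b ↓₊ᵃ = mk⇔ (map₂ (map₂ (proj₂ ∘ ∷-injective))) (map₂ (map₂ (cong (i ∷_))))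
∷-agree i a b ⟶ᵃ = mk⇔ strip (λ { (p , j , e₁ , e₂) → i ∷ p , j , cong (i ∷_) e₁ , cong (i ∷_) e₂ })
  where
  strip : (i ∷ a) ⟶ (i ∷ b) → a ⟶ b
  strip ([] , j , e₁ , e₂) with ∷-injective e₁ | ∷-injective e₂
  ... | refl , _ | () , _
  strip (_ ∷ p , j , e₁ , e₂) = p , j , proj₂ (∷-injective e₁) , proj₂ (∷-injective e₂)
∷-agree i a b ⟶⁺ᵃ = mk⇔ strip (λ { (p , j , l , j<l , e₁ , e₂) → i ∷ p , j , l , j<l , cong (i ∷_) e₁ , cong (i ∷_) e₂ })
  where
  strip : (i ∷ a) ⟶⁺ (i ∷ b) → a ⟶⁺ b
  strip ([] , j , l , j<l , e₁ , e₂) with ∷-injective e₁ | ∷-injective e₂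
  ... | refl , _ | refl , _ = ⊥-elim (<-irrefl refl j<l)
  strip (_ ∷ p , j , l , j<l , e₁ , e₂) = p , j , l , j<l , proj₂ (∷-injective e₁) , proj₂ (∷-injective e₂)
∷-agree i a b ≡ᵃ = mk⇔ (proj₂ ∘ ∷-injective) (cong (i ∷_))

++-agree : ∀ p a b → Agree (p ++ a) (p ++ b) a b
++-agree [] a b ρ = ⇔-refl
++-agree (i ∷ p) a b ρ = ⇔-trans (∷-agree i (p ++ a) (p ++ b) ρ) (++-agree p a b ρ)

sameOrder-reroot : ∀ p p' a b → SameOrder (p ++ a) (p ++ b) (p' ++ a) (p' ++ b)
sameOrder-reroot p p' a b =
  (λ ρ → ⇔-trans (++-agree p a b ρ) (⇔-sym (++-agree p' a b ρ))) ,
  (λ ρ → ⇔-trans (++-agree p b a ρ) (⇔-sym (++-agree p' b a ρ)))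

↓₊-++ : ∀ {y b q} → y ↓₊ b → y ↓₊ (b ++ q)
↓₊-++ y↓₊b = ↓₊-≼-trans y↓₊b ≼-++

out-of-below : ∀ {b q y} → ¬ b ≼ y → q ≢ [] → ∀ ρ → ¬ (b ++ q) ⟨ ρ ⟩ y
out-of-below b⋠y _ ↓ᵃ h = b⋠y (≼-trans ≼-++ (↓₊⇒≼ (↓⇒↓₊ h)))
out-of-below b⋠y _ ↓₊ᵃ h = b⋠y (≼-trans ≼-++ (↓₊⇒≼ h))
out-of-below {b} b⋠y q≢[] ⟶ᵃ (_ , i , e₁ , e₂) = b⋠y (≼-trans (≼-parent b q≢[] e₁) ([ suc i ] , e₂))
out-of-below {b} b⋠y q≢[] ⟶⁺ᵃ (_ , _ , j , _ , e₁ , e₂) = b⋠y (≼-trans (≼-parent b q≢[] e₁) ([ j ] , e₂))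
out-of-below b⋠y _ ≡ᵃ e = b⋠y (_ , sym e)

into-below : ∀ {b q y} → ¬ b ≼ y → q ≢ [] → ∀ ρ → y ⟨ ρ ⟩ (b ++ q) → ρ ≡ ↓₊ᵃ × y ↓₊ b
into-below {b} b⋠y q≢[] ↓ᵃ (i , e) = ⊥-elim (b⋠y (≼-parent b q≢[] e))
into-below {b} {y = y} b⋠y _ ↓₊ᵃ (_ , _ , e) with ++-comparable y b (sym e)
... | inj₂ b≼y = ⊥-elim (b⋠y b≼y)
... | inj₁ y≼b = refl , [ (λ { refl → ⊥-elim (b⋠y ≼-refl) }) , id ]′ (≼⇒≡⊎↓₊ y≼b)
into-below {b} b⋠y q≢[] ⟶ᵃ (_ , i , e₁ , e₂) = ⊥-elim (b⋠y (≼-trans (≼-parent b q≢[] e₂) ([ i ] , e₁)))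
into-below {b} b⋠y q≢[] ⟶⁺ᵃ (_ , i , _ , _ , e₁ , e₂) = ⊥-elim (b⋠y (≼-trans (≼-parent b q≢[] e₂) ([ i ] , e₁)))
into-below b⋠y _ ≡ᵃ e = ⊥-elim (b⋠y (_ , e))

sameOrder-below : ∀ {b b' q q' y y'} → q ≢ [] → q' ≢ [] → ¬ b ≼ y → ¬ b' ≼ y' →
                  (y ↓₊ b ⇔ y' ↓₊ b') → SameOrder (b ++ q) y (b' ++ q') y'
sameOrder-below q≢[] q'≢[] b⋠y b'⋠y' ancestor =
  (λ ρ → ⇔-absurd (out-of-below b⋠y q≢[] ρ) (out-of-below b'⋠y' q'≢[] ρ)) ,
  (λ ρ → mk⇔ (move b⋠y q≢[] (to ancestor) ρ) (move b'⋠y' q'≢[] (from ancestor) ρ))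
  where
  move : ∀ {b b' q q' y y'} → ¬ b ≼ y → q ≢ [] → (y ↓₊ b → y' ↓₊ b') →
         ∀ ρ → y ⟨ ρ ⟩ (b ++ q) → y' ⟨ ρ ⟩ (b' ++ q')
  move b⋠y q≢[] f ρ h with into-below b⋠y q≢[] ρ h
  ... | refl , y↓₊b = ↓₊-++ (f y↓₊b)

order-cong : ∀ {a b a' b'} → SameOrder a b a' b' → ∀ η → ⟦ η ⟧O a b ⇔ ⟦ η ⟧O a' b'
order-cong (f , g) child = f ↓ᵃ
order-cong (f , g) parent = g ↓ᵃ
order-cong (f , g) descNC = f ↓₊ᵃ ×-⇔ ¬-cong-⇔ (f ↓ᵃ)
order-cong (f , g) ancNC = g ↓₊ᵃ ×-⇔ ¬-cong-⇔ (g ↓ᵃ)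
order-cong (f , g) next = f ⟶ᵃ
order-cong (f , g) prev = g ⟶ᵃ
order-cong (f , g) foll = f ⟶⁺ᵃ ×-⇔ ¬-cong-⇔ (f ⟶ᵃ)
order-cong (f , g) precNC = g ⟶⁺ᵃ ×-⇔ ¬-cong-⇔ (g ⟶ᵃ)
order-cong (f , g) free =
  ¬-cong-⇔ (f ≡ᵃ) ×-⇔ ¬-cong-⇔ (f ↓₊ᵃ) ×-⇔ ¬-cong-⇔ (g ↓₊ᵃ) ×-⇔ ¬-cong-⇔ (f ⟶⁺ᵃ) ×-⇔ ¬-cong-⇔ (g ⟶⁺ᵃ)
order-cong (f , g) same = f ≡ᵃ

downward-or-outward : ∀ η → (∀ {a y} → ⟦ η ⟧O a y → a ≼ y) ⊎ (∀ {a y} → ⟦ η ⟧O a y → ¬ a ≼ y)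
downward-or-outward child = inj₁ (↓₊⇒≼ ∘ ↓⇒↓₊)
downward-or-outward descNC = inj₁ (↓₊⇒≼ ∘ proj₁)
downward-or-outward same = inj₁ ≼-reflexive
downward-or-outward parent = inj₂ (↓₊⇒⋡ ∘ ↓⇒↓₊)
downward-or-outward ancNC = inj₂ (↓₊⇒⋡ ∘ proj₁)
downward-or-outward next = inj₂ (⟶⁺⇒⋡ ∘ ⟶⇒⟶⁺)
downward-or-outward prev = inj₂ (⟶⁺⇒⋡˘ ∘ ⟶⇒⟶⁺)
downward-or-outward foll = inj₂ (⟶⁺⇒⋡ ∘ proj₁)
downward-or-outward precNC = inj₂ (⟶⁺⇒⋡˘ ∘ proj₁)
downward-or-outward free = inj₂ λ { (a≢y , a⋫y , _) a≼y → [ a≢y ∘ sym , a⋫y ]′ (≼⇒≡⊎↓₊ a≼y) }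

mutual
  subAt-++ : ∀ {k} (t : Tree k) {u} p q → subAt t p ≡ just u → subAt t (p ++ q) ≡ subAt u q
  subAt-++ t [] q refl = refl
  subAt-++ (node α ts) (i ∷ p) q e = subAtL-++ ts i p q e

  subAtL-++ : ∀ {k} (ts : List (Tree k)) {u} i p q → subAtL ts i p ≡ just u → subAtL ts i (p ++ q) ≡ subAt u q
  subAtL-++ [] i p q ()
  subAtL-++ (t ∷ ts) zero p q e = subAt-++ t p q e
  subAtL-++ (t ∷ ts) (suc i) p q e = subAtL-++ ts i p q e

mutual
  subAt-replace-++ : ∀ {k} (t s : Tree k) {u} v q → subAt t v ≡ just u → subAt (replace t v s) (v ++ q) ≡ subAt s q
  subAt-replace-++ t s [] q e = refl
  subAt-replace-++ (node α ts) s (i ∷ v) q e = subAtL-replaceL-++ ts s i v q e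

  subAtL-replaceL-++ : ∀ {k} (ts : List (Tree k)) s {u} i v q → subAtL ts i v ≡ just u →
                       subAtL (replaceL ts i v s) i (v ++ q) ≡ subAt s q
  subAtL-replaceL-++ [] s i v q ()
  subAtL-replaceL-++ (t ∷ ts) s zero v q e = subAt-replace-++ t s v q e
  subAtL-replaceL-++ (t ∷ ts) s (suc i) v q e = subAtL-replaceL-++ ts s i v q e

subAtL-replaceL-≢ : ∀ {k} (ts : List (Tree k)) s {i j} v x → i ≢ j → subAtL (replaceL ts i v s) j x ≡ subAtL ts j x
subAtL-replaceL-≢ [] s v x i≢j = refl
subAtL-replaceL-≢ (t ∷ ts) s {zero} {zero} v x i≢j = ⊥-elim (i≢j refl)
subAtL-replaceL-≢ (t ∷ ts) s {zero} {suc j} v x i≢j = refl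
subAtL-replaceL-≢ (t ∷ ts) s {suc i} {zero} v x i≢j = refl
subAtL-replaceL-≢ (t ∷ ts) s {suc i} {suc j} v x i≢j = subAtL-replaceL-≢ ts s v x (i≢j ∘ cong suc)

-- Only the 1-type survives: an ancestor of v keeps its label but not its subtree.
mutual
  tpAt-replace-outside : ∀ {k} (t s : Tree k) v x → ¬ v ≼ x → tpAt (replace t v s) x ≡ tpAt t x
  tpAt-replace-outside t s [] x v⋠x = ⊥-elim (v⋠x (x , refl))
  tpAt-replace-outside (node α ts) s (i ∷ v) [] v⋠x = refl
  tpAt-replace-outside (node α ts) s (i ∷ v) (j ∷ x) v⋠x with i ≟ j
  ... | yes refl = tpAtL-replaceL-outside ts s i v x (v⋠x ∘ ∷-≼)
  ... | no i≢j = cong (map rootTp) (subAtL-replaceL-≢ ts s v x i≢j)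

  tpAtL-replaceL-outside : ∀ {k} (ts : List (Tree k)) s i v x → ¬ v ≼ x →
                           map rootTp (subAtL (replaceL ts i v s) i x) ≡ map rootTp (subAtL ts i x)
  tpAtL-replaceL-outside [] s i v x v⋠x = refl
  tpAtL-replaceL-outside (t ∷ ts) s zero v x v⋠x = tpAt-replace-outside t s v x v⋠x
  tpAtL-replaceL-outside (t ∷ ts) s (suc i) v x v⋠x = tpAtL-replaceL-outside ts s i v x v⋠x

node-type : ∀ {k} (t : Tree k) a → IsNode t a → ∃[ β ] (tpAt t a ≡ just β)
node-type t a (u , e) = rootTp u , cong (map rootTp) e

isNode-transfer : ∀ {k} (T₁ : Tree k) a (T₂ : Tree k) b → tpAt T₁ a ≡ tpAt T₂ b → IsNode T₁ a → IsNode T₂ b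
isNode-transfer T₁ a T₂ b e (u , e₁) with subAt T₁ a | subAt T₂ b
... | _ | just u' = u' , refl
... | just _ | nothing with () ← e
... | nothing | nothing with () ← e₁

holds-cong : ∀ {k j} (T₁ : Tree k) a (T₂ : Tree k) b → tpAt T₁ a ≡ tpAt T₂ b → HoldsP T₁ j a ⇔ HoldsP T₂ j b
holds-cong T₁ a T₂ b e = mk⇔ (λ { (α , e₁ , j∈α) → α , trans (sym e) e₁ , j∈α })
                             (λ { (α , e₁ , j∈α) → α , trans e e₁ , j∈α })

module Transfer {k} {T₁ T₂ : Tree k} {x y x₀ y₀ : Path}
  (tp-x : tpAt T₁ x ≡ tpAt T₂ x₀) (tp-y : tpAt T₁ y ≡ tpAt T₂ y₀) where

  env-tp : ∀ a → tpAt T₁ (env x y a) ≡ tpAt T₂ (env x₀ y₀ a)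
  env-tp vx = tp-x
  env-tp vy = tp-y

  unary-cong : ∀ ψ → ⟦ ψ ⟧U T₁ x y ⇔ ⟦ ψ ⟧U T₂ x₀ y₀
  unary-cong (uatom j a) = holds-cong T₁ (env x y a) T₂ (env x₀ y₀ a) (env-tp a)
  unary-cong (uneg ψ) = ¬-cong-⇔ (unary-cong ψ)
  unary-cong (uand ψ ψ') = unary-cong ψ ×-⇔ unary-cong ψ'
  unary-cong (uor ψ ψ') = unary-cong ψ ⊎-⇔ unary-cong ψ'

  module _ (order : SameOrder x y x₀ y₀) where

    env-order : ∀ a b → SameOrder (env x y a) (env x y b) (env x₀ y₀ a) (env x₀ y₀ b)
    env-order vx vx = sameOrder-self x x₀
    env-order vx vy = order
    env-order vy vx = swap order
    env-order vy vy = sameOrder-self y y₀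

    atom-cong : ∀ at → ⟦ at ⟧A T₁ x y ⇔ ⟦ at ⟧A T₂ x₀ y₀
    atom-cong (unA j a) = holds-cong T₁ (env x y a) T₂ (env x₀ y₀ a) (env-tp a)
    atom-cong (eqA a b) = proj₁ (env-order a b) ≡ᵃ
    atom-cong (chA a b) = proj₁ (env-order a b) ↓ᵃ
    atom-cong (dsA a b) = proj₁ (env-order a b) ↓₊ᵃ
    atom-cong (nxA a b) = proj₁ (env-order a b) ⟶ᵃ
    atom-cong (rsA a b) = proj₁ (env-order a b) ⟶⁺ᵃ

    qf-cong : ∀ χ → ⟦ χ ⟧Q T₁ x y ⇔ ⟦ χ ⟧Q T₂ x₀ y₀
    qf-cong (atom at) = atom-cong at
    qf-cong (neg χ) = ¬-cong-⇔ (qf-cong χ)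
    qf-cong (and χ χ') = qf-cong χ ×-⇔ qf-cong χ'
    qf-cong (or χ χ') = qf-cong χ ⊎-⇔ qf-cong χ'

Witness : ∀ {k} → Tree k → Ord → UB k → Path → Set
Witness T η ψ x = ∃[ y ] (IsNode T y × ⟦ η ⟧O x y × ⟦ ψ ⟧U T x y)

witness-transfer : ∀ {k} {T T₀ : Tree k} {η ψ x y x₀ y₀} →
                   tpAt T x ≡ tpAt T₀ x₀ → tpAt T y ≡ tpAt T₀ y₀ → IsNode T₀ y₀ →
                   ⟦ η ⟧O x y → ⟦ ψ ⟧U T₀ x₀ y₀ → Witness T η ψ x
witness-transfer {T = T} {T₀} {ψ = ψ} {y = y} {y₀ = y₀} tp-x tp-y y₀∈T₀ hη hψ =
  y , isNode-transfer T₀ y₀ T y (sym tp-y) y₀∈T₀ , hη , from (Transfer.unary-cong tp-x tp-y ψ) hψ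

module Replacement {k} (t s : Tree k) {v r : Path}
  (v∈t : IsNode t v) (w↦s : subAt t (v ++ r) ≡ just s) (r≢[] : r ≢ [])
  (same-rftp : rftp t v ≈R rftp t (v ++ r)) where

  w : Path
  w = v ++ r

  T' : Tree k
  T' = replace t v s

  same-ancestors : ∀ β → Rftp.A (rftp t v) β ⇔ Rftp.A (rftp t w) β
  same-ancestors = proj₁ (proj₂ same-rftp)

  same-descendants : ∀ β → Rftp.B (rftp t v) β ⇔ Rftp.B (rftp t w) β
  same-descendants = proj₁ (proj₂ (proj₂ same-rftp))

  same-others : ∀ β → Rftp.F (rftp t v) β ⇔ Rftp.F (rftp t w) β
  same-others = proj₂ (proj₂ (proj₂ same-rftp))

  w⋠ : ∀ {y} → ¬ v ≼ y → ¬ w ≼ y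
  w⋠ v⋠y = v⋠y ∘ ≼-trans ≼-++

  tp-inside : ∀ q → tpAt T' (v ++ q) ≡ tpAt t (w ++ q)
  tp-inside q = cong (map rootTp) (trans (subAt-replace-++ t s v q (proj₂ v∈t)) (sym (subAt-++ t w q w↦s)))

  tp-outside : ∀ {x} → ¬ v ≼ x → tpAt T' x ≡ tpAt t x
  tp-outside = tpAt-replace-outside t s v _

  tp-root : tpAt T' (v ++ []) ≡ tpAt t (v ++ [])
  tp-root = begin
    tpAt T' (v ++ [])  ≡⟨ tp-inside [] ⟩
    tpAt t (w ++ [])   ≡⟨ cong (tpAt t) (++-identityʳ w) ⟩
    tpAt t w           ≡⟨ sym (proj₁ same-rftp) ⟩
    tpAt t v           ≡⟨ cong (tpAt t) (sym (++-identityʳ v)) ⟩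
    tpAt t (v ++ [])   ∎
    where open ≡-Reasoning

  matching-descendant : ∀ {q} → q ≢ [] → IsNode t (v ++ q) →
                        ∃[ q' ] (q' ≢ [] × tpAt t (w ++ q') ≡ tpAt t (v ++ q))
  matching-descendant {q} q≢[] v·q∈t = match (node-type t (v ++ q) v·q∈t)
    where
    match : ∃[ β ] (tpAt t (v ++ q) ≡ just β) → ∃[ q' ] (q' ≢ [] × tpAt t (w ++ q') ≡ tpAt t (v ++ q))
    match (β , eβ) with to (same-descendants β) (v ++ q , (q , q≢[] , refl) , eβ)
    ... | _ , (q' , q'≢[] , refl) , e = q' , q'≢[] , trans e (sym eβ)

  matching-outsider : ∀ {y} → ¬ w ≼ y → IsNode t y →
                      ∃[ y' ] (¬ v ≼ y' × tpAt t y' ≡ tpAt t y × (y ↓₊ w ⇔ y' ↓₊ v))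
  matching-outsider {y} w⋠y y∈t = match (node-type t y y∈t)
    where
    match : ∃[ β ] (tpAt t y ≡ just β) → ∃[ y' ] (¬ v ≼ y' × tpAt t y' ≡ tpAt t y × (y ↓₊ w ⇔ y' ↓₊ v))
    match (β , eβ) with y ↓₊? w
    ... | yes y↓₊w with from (same-ancestors β) (y , y↓₊w , eβ)
    ...   | a , a↓₊v , e = a , ↓₊⇒⋡ a↓₊v , trans e (sym eβ) , mk⇔ (λ _ → a↓₊v) (λ _ → y↓₊w)
    match (β , eβ) | no y⋫w with from (same-others β) (y , (λ { refl → w⋠y ≼-refl }) , y⋫w , w⋠y ∘ ↓₊⇒≼ , eβ)
    ... | u , u≢v , u⋫v , v⋫u , e =
      u , (λ v≼u → [ u≢v , v⋫u ]′ (≼⇒≡⊎↓₊ v≼u)) , trans e (sym eβ) , ⇔-absurd y⋫w u⋫v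

  ancestor-of-w : ∀ {y} → ¬ v ≼ y → y ↓₊ v ⇔ y ↓₊ w
  ancestor-of-w v⋠y = mk⇔ ↓₊-++ (proj₂ ∘ into-below v⋠y r≢[] ↓₊ᵃ)

  record Counterparts (x y : Path) : Set where
    constructor counterparts
    field
      x₀ y₀ : Path
      tp-x : tpAt T' x ≡ tpAt t x₀
      tp-y : tpAt T' y ≡ tpAt t y₀
      order : SameOrder x y x₀ y₀

  -- The root v keeps its own place when paired with an outside node, but is matched with w
  -- when paired with a node of the transplanted subtree.
  counterparts-inside-outside : ∀ q {y} → ¬ v ≼ y → Counterparts (v ++ q) y
  counterparts-inside-outside [] v⋠y = counterparts (v ++ []) _ tp-root (tp-outside v⋠y) sameOrder-refl
  counterparts-inside-outside q@(_ ∷ _) v⋠y = counterparts (w ++ q) _ (tp-inside q) (tp-outside v⋠y)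
    (sameOrder-below (λ ()) (λ ()) v⋠y (w⋠ v⋠y) (ancestor-of-w v⋠y))

  counterparts-of : ∀ x y → Counterparts x y
  counterparts-of x y with position v x | position v y
  ... | outside v⋠x | outside v⋠y = counterparts x y (tp-outside v⋠x) (tp-outside v⋠y) sameOrder-refl
  ... | inside q₁ | inside q₂ = counterparts (w ++ q₁) (w ++ q₂) (tp-inside q₁) (tp-inside q₂) (sameOrder-reroot v w q₁ q₂)
  ... | inside q | outside v⋠y = counterparts-inside-outside q v⋠y
  ... | outside v⋠x | inside q with counterparts-inside-outside q v⋠x
  ...   | counterparts x₀ y₀ tp-x tp-y order = counterparts y₀ x₀ tp-y tp-x (swap order)

  χ-preserved : ∀ χ → (∀ x y → IsNode t x → IsNode t y → ⟦ χ ⟧Q t x y) →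
                ∀ x y → IsNode T' x → IsNode T' y → ⟦ χ ⟧Q T' x y
  χ-preserved χ hχ x y x∈T' y∈T' with counterparts-of x y
  ... | counterparts x₀ y₀ tp-x tp-y order =
    from (Transfer.qf-cong tp-x tp-y order χ) (hχ x₀ y₀ (isNode-transfer T' x t x₀ tp-x x∈T') (isNode-transfer T' y t y₀ tp-y y∈T'))

  module _ {η : Ord} {ψ : UB k} where

    witness-in-subtree : ∀ q q₂ → IsNode t (w ++ q₂) → ⟦ η ⟧O (w ++ q) (w ++ q₂) →
                         ⟦ ψ ⟧U t (w ++ q) (w ++ q₂) → Witness T' η ψ (v ++ q)
    witness-in-subtree q q₂ y∈t hη hψ =
      witness-transfer (tp-inside q) (tp-inside q₂) y∈t (to (order-cong (sameOrder-reroot w v q q₂) η) hη) hψ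

    witness-outside : ∀ {x} → ¬ v ≼ x → Witness t η ψ x → Witness T' η ψ x
    witness-outside {x} v⋠x (y , y∈t , hη , hψ) with position v y
    ... | outside v⋠y = witness-transfer (tp-outside v⋠x) (tp-outside v⋠y) y∈t hη hψ
    ... | inside [] = witness-transfer (tp-outside v⋠x) tp-root y∈t hη hψ
    ... | inside q@(_ ∷ _) with matching-descendant (λ ()) y∈t
    ...   | q' , q'≢[] , e = witness-transfer (tp-outside v⋠x) (trans (tp-inside q') e) y∈t
      (to (order-cong (swap (sameOrder-below (λ ()) q'≢[] v⋠x v⋠x ⇔-refl)) η) hη) hψ

    -- A downward witness of w lies in w's subtree and is transplanted with it; any other
    -- witness of v lies outside v's subtree and stays in place.
    witness-root : (∀ {x₀} → tpAt T' (v ++ []) ≡ tpAt t x₀ → Witness t η ψ x₀) → Witness T' η ψ (v ++ [])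
    witness-root sat-at with downward-or-outward η
    ... | inj₁ downward with sat-at (tp-inside [])
    ...   | y , y∈t , hη , hψ with ≼-trans (≼-++ {w}) (downward hη)
    ...     | q₂ , refl = witness-in-subtree [] q₂ y∈t hη hψ
    witness-root sat-at | inj₂ outward with sat-at tp-root
    ... | y , y∈t , hη , hψ =
      witness-transfer tp-root (tp-outside (outward hη ∘ ≼-trans (≼-reflexive (++-identityʳ v)))) y∈t hη hψ

    witness-below : ∀ {q} → q ≢ [] → Witness t η ψ (w ++ q) → Witness T' η ψ (v ++ q)
    witness-below {q} q≢[] (y , y∈t , hη , hψ) with position w y
    ... | inside q₂ = witness-in-subtree q q₂ y∈t hη hψ
    ... | outside w⋠y with matching-outsider w⋠y y∈t
    ...   | y' , v⋠y' , e , ancestor = witness-transfer (tp-inside q) (trans (tp-outside v⋠y') e) y∈t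
      (to (order-cong (sameOrder-below q≢[] q≢[] w⋠y v⋠y' ancestor) η) hη) hψ

  sat-at : ∀ {l η ψ x₀} → SatConj t (conj l η ψ) → ∀ x → IsNode T' x → HoldsP T' l x →
           tpAt T' x ≡ tpAt t x₀ → Witness t η ψ x₀
  sat-at {x₀ = x₀} sat x x∈T' lx e = sat x₀ (isNode-transfer T' x t x₀ e x∈T') (to (holds-cong T' x t x₀ e) lx)

  conj-preserved : ∀ {c} → SatConj t c → SatConj T' c
  conj-preserved {conj l η ψ} sat x x∈T' lx with position v x
  ... | outside v⋠x = witness-outside v⋠x (sat-at sat x x∈T' lx (tp-outside v⋠x))
  ... | inside [] = witness-root (sat-at sat x x∈T' lx)
  ... | inside q@(_ ∷ _) = witness-below (λ ()) (sat-at sat x x∈T' lx (tp-inside q))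

lemma2 : ∀ {k : ℕ} (φ : NF k) (t : Tree k) (v w : Path) (s : Tree k)
           → t ⊨ φ
           → IsNode t v
           → subAt t w ≡ just s
           → v ↓₊ w
           → rftp t v ≈R rftp t w
           → replace t v s ⊨ φ
lemma2 (nf χ cs) t v _ s (hχ , hcs) v∈t w↦s (r , r≢[] , refl) same-rftp =
  χ-preserved χ hχ , All.map conj-preserved hcs
  where open Replacement t s v∈t w↦s r≢[] same-rftp
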